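{- Let $P$ be a finite poset and let $r : P \to P$ be an ascending closure operator, regarded as a map $r : P \to r(P)$ onto its image (with the order induced from $P$). Then for every function $h : P \to \mathbb{Z}$, the pushforward $r_* h$ coincides with the restriction $h|_{r(P)}$, i.e. $r_*h(x) = h(x)$ for all $x \in r(P)$.
   Context: An ascending closure operator on a poset $P$ is an order-preserving map $r : P \to P$ with $r \circ r = r$ and $r(x) \ge x$ for all $x \in P$. For a finite poset $P$, the zeta matrix is $\zeta(x,y)=1$ if $x\le y$ and $0$ otherwise, and the Euler characteristic is $\chi(P) = \sum_{x,y}\zeta^{ -1}(x,y)$ ($\chi(\emptyset)=0$). A filter is an upward closed subset; $\delta_Q$ denotes the indicator function of $Q$. Every $f : P \to \mathbb{Z}$ can be written as $f = \sum_i a_i\delta_{Q_i}$ with $a_i\in\mathbb{Z}$ and $Q_i$ filters of $P$, and $\int_P f\,d\chi = \sum_i a_i \chi(Q_i)$ (independent of the decomposition). For a subset $S \subseteq P$ (with induced order) and $h : P \to \mathbb{Z}$, $\int_S h\,d\chi$ means $\int_S h|_S\, d\chi$. For an order-preserving map $f : P \to Q$ of finite posets and $h : P \to \mathbb{Z}$, the pushforward $f_*h : Q \to \mathbb{Z}$ is $f_*h(x) = \int_{f^{ -1}(Q_{\le x})} h\, d\chi$, where $Q_{\le x} = \{y \in Q \mid y \le x\}$. -}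

module Defs where

open import Data.Nat using (ℕ; zero; suc)
open import Data.Fin using (Fin)
open import Data.Fin.Properties using () renaming (_≟_ to _≟ᶠ_)
open import Data.Bool using (Bool; true; false; if_then_else_; _∧_; not)
open import Data.Integer using (ℤ; _+_; _*_; -_; 0ℤ; 1ℤ)
open import Data.List using (List; []; _∷_; foldr; allFin; map)
open import Data.List.Relation.Unary.All using (All)
open import Data.Product using (_×_; _,_; proj₁; proj₂; Σ; ∃)
open import Relation.Binary using (Rel; IsDecPartialOrder)
open import Relation.Binary.PropositionalEquality using (_≡_)
open import Relation.Nullary.Decidable using (⌊_⌋)
open import Level using (0ℓ)

record FinPoset : Set₁ where
  field
    size  : ℕ
    _≤_   : Rel (Fin size) 0ℓ
    isDecPartialOrder : IsDecPartialOrder _≡_ _≤_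
  open IsDecPartialOrder isDecPartialOrder public
    using (_≤?_)

  Elt : Set
  Elt = Fin size

  leB : Elt → Elt → Bool
  leB x y = ⌊ x ≤? y ⌋

  eqB : Elt → Elt → Bool
  eqB x y = ⌊ x ≟ᶠ y ⌋

Subset : FinPoset → Set
Subset P = FinPoset.Elt P → Bool

Σℤ : {n : ℕ} → (Fin n → ℤ) → ℤ
Σℤ {n} f = foldr (λ i acc → f i + acc) 0ℤ (allFin n)

[_] : Bool → ℤ
[ true ]  = 1ℤ
[ false ] = 0ℤ

module _ (P : FinPoset) where
  open FinPoset P

  -- Möbius function (entries of ζ⁻¹) of the subposet Q ⊆ P with the
  -- induced order, defined by the standard recursion
  --   μ(x,x) = 1,  μ(x,y) = - Σ_{z ∈ Q, x ≤ z < y} μ(x,z)  (x < y),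
  --   μ(x,y) = 0 otherwise,
  -- which is the unique solution of μ ζ = I (i.e. μ = ζ⁻¹).  The first
  -- argument is fuel; fuel = size suffices since chains have length < size.
  möbiusF : ℕ → Subset P → Elt → Elt → ℤ
  möbiusF zero    Q x y = 0ℤ
  möbiusF (suc k) Q x y =
    if eqB x y then 1ℤ
    else if leB x y then
      - Σℤ (λ z → [ Q z ∧ leB x z ∧ leB z y ∧ not (eqB z y) ] * möbiusF k Q x z)
    else 0ℤ

  -- ζ⁻¹(x,y) for the subposet Q (only meaningful for x, y ∈ Q)
  zetaInv : Subset P → Elt → Elt → ℤ
  zetaInv Q = möbiusF size Q

  χ : Subset P → ℤ
  χ Q = Σℤ (λ x → Σℤ (λ y → [ Q x ∧ Q y ] * zetaInv Q x y))

  IsFilterIn : Subset P → Subset P → Set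
  IsFilterIn S Q =
    (∀ p → Q p ≡ true → S p ≡ true) ×
    (∀ p q → Q p ≡ true → S q ≡ true → p ≤ q → Q q ≡ true)

  IsFilterDecomp : Subset P → (Elt → ℤ) → List (ℤ × Subset P) → Set
  IsFilterDecomp S h d =
    All (λ aQ → IsFilterIn S (proj₂ aQ)) d ×
    (∀ p → S p ≡ true →
       foldr (λ aQ acc → proj₁ aQ * [ proj₂ aQ p ] + acc) 0ℤ d ≡ h p)

  decompValue : List (ℤ × Subset P) → ℤ
  decompValue d = foldr (λ aQ acc → proj₁ aQ * χ (proj₂ aQ) + acc) 0ℤ d

  -- "∫_S h dχ = c": h|_S admits a filter decomposition, and every such
  -- decomposition Σ aᵢ δ_{Qᵢ} gives Σ aᵢ χ(Qᵢ) = c.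
  IntegralIs : Subset P → (Elt → ℤ) → ℤ → Set
  IntegralIs S h c =
    (Σ (List (ℤ × Subset P)) (IsFilterDecomp S h)) ×
    (∀ d → IsFilterDecomp S h d → decompValue d ≡ c)

  record IsAscendingClosure (r : Elt → Elt) : Set where
    field
      monotone   : ∀ x y → x ≤ y → r x ≤ r y
      idempotent : ∀ x → r (r x) ≡ r x
      ascending  : ∀ x → x ≤ r x

  -- Pushforward along r : P → r(P):  (r_* h)(x) = ∫_{r⁻¹(r(P)_{≤x})} h dχ.
  -- The preimage r⁻¹(r(P)_{≤x}) is {p ∈ P | r p ≤ x}.
  preimageBelow : (Elt → Elt) → Elt → Subset P
  preimageBelow r x p = leB (r p) x

  PushforwardIs : (Elt → Elt) → (Elt → ℤ) → Elt → ℤ → Set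
  PushforwardIs r h x c = IntegralIs (preimageBelow r x) h c

{-# OPTIONS --safe #-}
module Submission where

-- Since x = r y is fixed by r, the preimage S = {p | r p ≤ x} has x as its top element:
-- x ∈ S because r x = x, and p ∈ S gives p ≤ r p ≤ x. A finite poset with a maximum m
-- has χ = 1, because each row of ζ⁻¹ sums to Σ_y ζ⁻¹(x,y) ζ(y,m) = δ(x,m). A filter of S
-- is either empty or has x as its maximum, so χ(Q) = δ_Q(x) for every filter Q of S, and
-- any filter decomposition h = Σ aᵢ δ_{Qᵢ} on S integrates to Σ aᵢ δ_{Qᵢ}(x) = h(x).
-- Such a decomposition exists: h = Σ_p h(p) (δ_{S ∩ P≥p} − δ_{S ∩ P>p}).

open import Defs
import Data.Integer.Properties as ℤₚ
open import Algebra.Properties.CommutativeMonoid.Sum ℤₚ.+-0-commutativeMonoid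
  using (sum; sum-cong-≗; sum-replicate-zero)
open import Algebra.Properties.CommutativeSemigroup ℤₚ.+-commutativeSemigroup
  using (x∙yz≈y∙xz)
open import Data.Bool using (Bool; true; false; _∧_; not)
open import Data.Bool.Properties using (∧-zeroʳ; ∧-identityʳ; ¬-not)
open import Data.Fin using (Fin; zero; suc)
open import Data.Fin.Properties using (_≟_)
import Data.Fin.Properties as Fₚ
import Data.Fin.Subset as Sub
import Data.Fin.Subset.Properties as Subₚ
open import Data.Integer using (ℤ; _+_; _*_; -_; 0ℤ; 1ℤ)
open import Data.List using (List; []; _∷_; foldr; allFin; tabulate)
open import Data.List.Relation.Unary.All using (All; []; _∷_)
open import Data.Nat as ℕ using (ℕ; zero; suc; _<_)
import Data.Nat.Properties as ℕₚ
open import Data.Product using (Σ; ∃; _×_; _,_; proj₁; proj₂)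
import Data.Vec as Vec
import Data.Vec.Properties as Vecₚ
open import Function using (_∘_; id)
open import Relation.Binary using (IsDecPartialOrder)
open import Relation.Binary.PropositionalEquality
  using (_≡_; _≢_; refl; sym; trans; cong; cong₂; subst; module ≡-Reasoning)
open import Relation.Nullary using (Dec; yes; no; ¬_; contradiction)
open import Relation.Nullary.Decidable
  using (⌊_⌋; dec-true; dec-false; isYes≗does; ⌊⌋-map′)

⌊⌋≡true⇒ : ∀ {a} {A : Set a} (a? : Dec A) → ⌊ a? ⌋ ≡ true → A
⌊⌋≡true⇒ (yes a) _ = a

⌊⌋≡true : ∀ {a} {A : Set a} (a? : Dec A) → A → ⌊ a? ⌋ ≡ true
⌊⌋≡true a? a = trans (isYes≗does a?) (dec-true a? a)

⌊⌋≡false : ∀ {a} {A : Set a} (a? : Dec A) → ¬ A → ⌊ a? ⌋ ≡ false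
⌊⌋≡false a? ¬a = trans (isYes≗does a?) (dec-false a? ¬a)

[]*-cong : ∀ b {u v} → (b ≡ true → u ≡ v) → [ b ] * u ≡ [ b ] * v
[]*-cong true  u≡v = cong (1ℤ *_) (u≡v refl)
[]*-cong false _   = refl

[]*-zero : ∀ b {u} → (b ≡ true → u ≡ 0ℤ) → [ b ] * u ≡ 0ℤ
[]*-zero b u≡0 = trans ([]*-cong b u≡0) (ℤₚ.*-zeroʳ [ b ])

[]*[]* : ∀ a b u → [ a ] * ([ b ] * u) ≡ [ b ∧ a ] * u
[]*[]* true  true  u = ℤₚ.*-identityˡ ([ true ] * u)
[]*[]* true  false u = refl
[]*[]* false true  u = refl
[]*[]* false false u = refl

∧-shuffle : ∀ a b c d → a ∧ ((b ∧ c) ∧ d) ≡ b ∧ (a ∧ (c ∧ d))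
∧-shuffle a true  c d = refl
∧-shuffle a false c d = ∧-zeroʳ a

∧≡true⇒ : ∀ {a b} → a ∧ b ≡ true → a ≡ true × b ≡ true
∧≡true⇒ {true} b≡true = refl , b≡true

foldr-tabulate : ∀ {n} {A : Set} (f : A → ℤ) (g : Fin n → A) →
  foldr (λ a acc → f a + acc) 0ℤ (tabulate g) ≡ sum (f ∘ g)
foldr-tabulate {zero}  f g = refl
foldr-tabulate {suc n} f g = cong (f (g zero) +_) (foldr-tabulate f (g ∘ suc))

Σℤ≡sum : ∀ {n} (f : Fin n → ℤ) → Σℤ f ≡ sum f
Σℤ≡sum f = foldr-tabulate f id

Σℤ-cong : ∀ {n} {f g : Fin n → ℤ} → (∀ i → f i ≡ g i) → Σℤ f ≡ Σℤ g
Σℤ-cong {f = f} {g} f≗g =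
  trans (Σℤ≡sum f) (trans (sum-cong-≗ f≗g) (sym (Σℤ≡sum g)))

Σℤ-zero : ∀ {n} {f : Fin n → ℤ} → (∀ i → f i ≡ 0ℤ) → Σℤ f ≡ 0ℤ
Σℤ-zero {n} {f} f≗0 = trans (Σℤ≡sum f) (trans (sum-cong-≗ f≗0) (sum-replicate-zero n))

sum-split-at : ∀ {n} (m : Fin n) (f : Fin n → ℤ) →
  sum f ≡ f m + sum (λ i → [ not ⌊ i ≟ m ⌋ ] * f i)
sum-split-at {suc n} zero f = cong (f zero +_) (begin
  sum (f ∘ suc)                    ≡⟨ sum-cong-≗ (λ i → sym (ℤₚ.*-identityˡ (f (suc i)))) ⟩
  sum (λ i → 1ℤ * f (suc i))       ≡⟨ sym (ℤₚ.+-identityˡ _) ⟩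
  0ℤ + sum (λ i → 1ℤ * f (suc i))  ∎)
  where open ≡-Reasoning
sum-split-at {suc n} (suc m) f = begin
  f zero + sum (f ∘ suc)
    ≡⟨ cong (f zero +_) (sum-split-at m (f ∘ suc)) ⟩
  f zero + (f (suc m) + rest)
    ≡⟨ x∙yz≈y∙xz (f zero) (f (suc m)) rest ⟩
  f (suc m) + (f zero + rest)
    ≡⟨ cong (λ t → f (suc m) + (t + rest)) (sym (ℤₚ.*-identityˡ (f zero))) ⟩
  f (suc m) + (1ℤ * f zero + rest)
    ≡⟨ cong (λ t → f (suc m) + (1ℤ * f zero + t)) (sum-cong-≗ ⌊suc≟suc⌋) ⟩
  f (suc m) + (1ℤ * f zero + sum (λ i → [ not ⌊ suc i ≟ suc m ⌋ ] * f (suc i)))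
    ∎
  where
  open ≡-Reasoning
  rest = sum (λ i → [ not ⌊ i ≟ m ⌋ ] * f (suc i))
  -- ⌊_⌋ is isYes, which, unlike does, does not compute through the map′ in Fin's _≟_.
  ⌊suc≟suc⌋ : ∀ i → [ not ⌊ i ≟ m ⌋ ] * f (suc i) ≡ [ not ⌊ suc i ≟ suc m ⌋ ] * f (suc i)
  ⌊suc≟suc⌋ i = cong (λ b → [ not b ] * f (suc i))
    (sym (⌊⌋-map′ (cong suc) Fₚ.suc-injective (i ≟ m)))

Σℤ-split-at : ∀ {n} (m : Fin n) (f : Fin n → ℤ) →
  Σℤ f ≡ f m + Σℤ (λ i → [ not ⌊ i ≟ m ⌋ ] * f i)
Σℤ-split-at m f = trans (Σℤ≡sum f) (trans (sum-split-at m f)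
  (cong (f m +_) (sym (Σℤ≡sum (λ i → [ not ⌊ i ≟ m ⌋ ] * f i)))))

module _ (P : FinPoset) where
  open FinPoset P
  open IsDecPartialOrder isDecPartialOrder using (antisym)
    renaming (refl to ≤-refl; trans to ≤-trans)

  leB⇒≤ : ∀ {x y} → leB x y ≡ true → x ≤ y
  leB⇒≤ {x} {y} = ⌊⌋≡true⇒ (x ≤? y)

  ≤⇒leB : ∀ {x y} → x ≤ y → leB x y ≡ true
  ≤⇒leB {x} {y} = ⌊⌋≡true (x ≤? y)

  eqB-refl : ∀ x → eqB x x ≡ true
  eqB-refl x = ⌊⌋≡true (x ≟ x) refl

  not-eqB⇒≢ : ∀ {x y} → not (eqB x y) ≡ true → x ≢ y
  not-eqB⇒≢ {x} {y} x≠y with x ≟ y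
  ... | no x≢y = x≢y
  not-eqB⇒≢ () | yes _

  below : Elt → Sub.Subset size
  below y = Vec.tabulate (λ w → leB w y)

  ∈below⁺ : ∀ {w y} → w ≤ y → w Sub.∈ below y
  ∈below⁺ {w} {y} w≤y =
    Vecₚ.lookup⇒[]= w (below y)
      (trans (Vecₚ.lookup∘tabulate (λ v → leB v y) w) (≤⇒leB w≤y))

  ∈below⁻ : ∀ {w y} → w Sub.∈ below y → w ≤ y
  ∈below⁻ {w} {y} w∈ =
    leB⇒≤ (trans (sym (Vecₚ.lookup∘tabulate (λ v → leB v y) w))
                 (Vecₚ.[]=⇒lookup w∈))

  height : Elt → ℕ
  height y = Sub.∣ below y ∣

  height-pos : ∀ y → 0 < height y
  height-pos y = subst (_< height y) (Subₚ.∣⊥∣≡0 size)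
    (Subₚ.p⊂q⇒∣p∣<∣q∣
      ((λ w∈⊥ → contradiction w∈⊥ Subₚ.∉⊥) , y , ∈below⁺ ≤-refl , Subₚ.∉⊥))

  height-< : ∀ {z y} → z ≤ y → z ≢ y → height z < height y
  height-< {z} {y} z≤y z≢y = Subₚ.p⊂q⇒∣p∣<∣q∣
    ( (λ w∈ → ∈below⁺ (≤-trans (∈below⁻ w∈) z≤y))
    , y , ∈below⁺ ≤-refl , λ y∈ → z≢y (antisym z≤y (∈below⁻ y∈)) )

  height≤size : ∀ y → height y ℕ.≤ size
  height≤size y = Subₚ.∣p∣≤n (below y)

  Ico : Subset P → Elt → Elt → Elt → Bool
  Ico Q x y z = Q z ∧ leB x z ∧ leB z y ∧ not (eqB z y)

  Ico⇒ : ∀ Q x y z → Ico Q x y z ≡ true → Q z ≡ true × x ≤ z × z ≤ y × z ≢ y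
  Ico⇒ Q x y z z∈ with Q z | x ≤? z | z ≤? y | z ≟ y
  ... | true  | yes x≤z | yes z≤y | no z≢y = refl , x≤z , z≤y , z≢y
  Ico⇒ Q x y z () | false | _     | _     | _
  Ico⇒ Q x y z () | true  | no _  | _     | _
  Ico⇒ Q x y z () | true  | yes _ | no _  | _
  Ico⇒ Q x y z () | true  | yes _ | yes _ | yes _

  möbius-refl : ∀ Q k x → möbiusF P (suc k) Q x x ≡ 1ℤ
  möbius-refl Q k x rewrite eqB-refl x = refl

  möbius-≰ : ∀ Q k {x y} → ¬ x ≤ y → möbiusF P k Q x y ≡ 0ℤ
  möbius-≰ Q zero    x≰y = refl
  möbius-≰ Q (suc k) {x} {y} x≰y with x ≟ y | x ≤? y
  ... | yes refl | _       = contradiction ≤-refl x≰y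
  ... | no _     | yes x≤y = contradiction x≤y x≰y
  ... | no _     | no _    = refl

  []*möbius : ∀ Q k x z b →
    [ b ] * möbiusF P k Q x z ≡ [ leB x z ∧ b ] * möbiusF P k Q x z
  []*möbius Q k x z b with x ≤? z
  ... | yes _   = refl
  ... | no x≰z  = trans (cong ([ b ] *_) (möbius-≰ Q k x≰z)) (ℤₚ.*-zeroʳ [ b ])

  möbius-< : ∀ Q k {x y} → x ≤ y → x ≢ y →
    möbiusF P (suc k) Q x y ≡ - Σℤ (λ z → [ Ico Q x y z ] * möbiusF P k Q x z)
  möbius-< Q k {x} {y} x≤y x≢y with x ≟ y | x ≤? y
  ... | yes x≡y | _      = contradiction x≡y x≢y
  ... | no _    | no x≰y = contradiction x≤y x≰y
  ... | no _    | yes _  = refl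

  möbius-stable : ∀ Q k x y → height y ℕ.≤ k →
    möbiusF P k Q x y ≡ möbiusF P (suc k) Q x y
  möbius-stable Q zero    x y h≤0 = contradiction (height-pos y) (ℕₚ.≤⇒≯ h≤0)
  möbius-stable Q (suc k) x y h≤k with x ≟ y | x ≤? y
  ... | yes _ | _     = refl
  ... | no _  | no _  = refl
  ... | no _  | yes _ = cong -_ (Σℤ-cong λ z → []*-cong (Ico Q x y z) λ z∈ →
    let (_ , _ , z≤y , z≢y) = Ico⇒ Q x y z z∈ in
    möbius-stable Q k x z (ℕₚ.≤-pred (ℕₚ.<-≤-trans (height-< z≤y z≢y) h≤k)))

  module _ (Q : Subset P) (k : ℕ) where

    möbius-ζ-diag : ∀ {y} → Q y ≡ true →
      Σℤ (λ z → [ Q z ∧ leB z y ] * möbiusF P (suc k) Q y z) ≡ 1ℤ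
    möbius-ζ-diag {y} Qy = begin
      Σℤ F                                      ≡⟨ Σℤ-split-at y F ⟩
      F y + Σℤ (λ z → [ not (eqB z y) ] * F z)  ≡⟨ cong₂ _+_ Fy≡1 (Σℤ-zero off-diagonal) ⟩
      1ℤ + 0ℤ                                   ∎
      where
      open ≡-Reasoning
      F : Elt → ℤ
      F z = [ Q z ∧ leB z y ] * möbiusF P (suc k) Q y z
      Fy≡1 : F y ≡ 1ℤ
      Fy≡1 = cong₂ (λ b u → [ b ] * u) (cong₂ _∧_ Qy (≤⇒leB ≤-refl)) (möbius-refl Q k y)
      off-diagonal : ∀ z → [ not (eqB z y) ] * F z ≡ 0ℤ
      off-diagonal z =
        []*-zero (not (eqB z y)) λ z≠y → []*-zero (Q z ∧ leB z y) λ z∈ →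
        möbius-≰ Q (suc k) λ y≤z →
        not-eqB⇒≢ z≠y (antisym (leB⇒≤ (proj₂ (∧≡true⇒ z∈))) y≤z)

    möbius-ζ-≰ : ∀ {x y} → ¬ x ≤ y →
      Σℤ (λ z → [ Q z ∧ leB z y ] * möbiusF P (suc k) Q x z) ≡ 0ℤ
    möbius-ζ-≰ {y = y} x≰y = Σℤ-zero λ z → []*-zero (Q z ∧ leB z y) λ z∈ →
      möbius-≰ Q (suc k) λ x≤z → x≰y (≤-trans x≤z (leB⇒≤ (proj₂ (∧≡true⇒ z∈))))

    möbius-ζ-< : ∀ {x y} → Q y ≡ true → height y ℕ.≤ suc k → x ≤ y → x ≢ y →
      Σℤ (λ z → [ Q z ∧ leB z y ] * möbiusF P (suc k) Q x z) ≡ 0ℤ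
    möbius-ζ-< {x} {y} Qy h≤k x≤y x≢y = begin
      Σℤ F                                      ≡⟨ Σℤ-split-at y F ⟩
      F y + Σℤ (λ z → [ not (eqB z y) ] * F z)  ≡⟨ cong₂ _+_ Fy≡-A (Σℤ-cong below-y) ⟩
      - A + A                                   ≡⟨ ℤₚ.+-inverseˡ A ⟩
      0ℤ                                        ∎
      where
      open ≡-Reasoning
      F : Elt → ℤ
      F z = [ Q z ∧ leB z y ] * möbiusF P (suc k) Q x z
      A : ℤ
      A = Σℤ (λ z → [ Ico Q x y z ] * möbiusF P k Q x z)
      Fy≡-A : F y ≡ - A
      Fy≡-A = begin
        [ Q y ∧ leB y y ] * möbiusF P (suc k) Q x y
          ≡⟨ cong (λ b → [ b ] * möbiusF P (suc k) Q x y) (cong₂ _∧_ Qy (≤⇒leB ≤-refl)) ⟩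
        1ℤ * möbiusF P (suc k) Q x y   ≡⟨ ℤₚ.*-identityˡ _ ⟩
        möbiusF P (suc k) Q x y        ≡⟨ möbius-< Q k x≤y x≢y ⟩
        - A                            ∎
      below-y : ∀ z → [ not (eqB z y) ] * F z ≡ [ Ico Q x y z ] * möbiusF P k Q x z
      below-y z = begin
        [ not (eqB z y) ] * ([ Q z ∧ leB z y ] * möbiusF P (suc k) Q x z)
          ≡⟨ []*[]* (not (eqB z y)) (Q z ∧ leB z y) _ ⟩
        [ (Q z ∧ leB z y) ∧ not (eqB z y) ] * möbiusF P (suc k) Q x z
          ≡⟨ []*möbius Q (suc k) x z _ ⟩
        [ leB x z ∧ ((Q z ∧ leB z y) ∧ not (eqB z y)) ] * möbiusF P (suc k) Q x z
          ≡⟨ cong (λ b → [ b ] * möbiusF P (suc k) Q x z)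
                  (∧-shuffle (leB x z) (Q z) (leB z y) (not (eqB z y))) ⟩
        [ Ico Q x y z ] * möbiusF P (suc k) Q x z
          ≡⟨ []*-cong (Ico Q x y z) (λ z∈ →
               let (_ , _ , z≤y , z≢y) = Ico⇒ Q x y z z∈ in
               sym (möbius-stable Q k x z
                      (ℕₚ.≤-pred (ℕₚ.<-≤-trans (height-< z≤y z≢y) h≤k)))) ⟩
        [ Ico Q x y z ] * möbiusF P k Q x z ∎

  möbius-ζ : ∀ Q k x y → Q y ≡ true → height y ℕ.≤ k →
    Σℤ (λ z → [ Q z ∧ leB z y ] * möbiusF P k Q x z) ≡ [ eqB x y ]
  möbius-ζ Q zero    x y Qy h≤0 = contradiction (height-pos y) (ℕₚ.≤⇒≯ h≤0)
  möbius-ζ Q (suc k) x y Qy h≤k with x ≟ y | x ≤? y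
  ... | yes refl | _       = möbius-ζ-diag Q k Qy
  ... | no _     | no x≰y  = möbius-ζ-≰ Q k x≰y
  ... | no x≢y   | yes x≤y = möbius-ζ-< Q k Qy h≤k x≤y x≢y

  χ-empty : ∀ Q → (∀ q → Q q ≡ false) → χ P Q ≡ 0ℤ
  χ-empty Q Q≡∅ = Σℤ-zero λ x → Σℤ-zero λ y →
    cong (λ b → [ b ∧ Q y ] * zetaInv P Q x y) (Q≡∅ x)

  χ-top : ∀ Q m → Q m ≡ true → (∀ q → Q q ≡ true → q ≤ m) → χ P Q ≡ 1ℤ
  χ-top Q m Qm ≤m = begin
    χ P Q
      ≡⟨ Σℤ-cong row ⟩
    Σℤ (λ x → [ Q x ∧ eqB x m ])
      ≡⟨ Σℤ-split-at m (λ x → [ Q x ∧ eqB x m ]) ⟩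
    [ Q m ∧ eqB m m ] + Σℤ (λ x → [ not (eqB x m) ] * [ Q x ∧ eqB x m ])
      ≡⟨ cong₂ _+_ (cong [_] (cong₂ _∧_ Qm (eqB-refl m))) (Σℤ-zero off-top) ⟩
    1ℤ + 0ℤ
      ∎
    where
    open ≡-Reasoning
    Q⊆↓m : ∀ y → Q y ≡ Q y ∧ leB y m
    Q⊆↓m y with Q y in Qy
    ... | false = refl
    ... | true  = sym (≤⇒leB (≤m y Qy))
    row : ∀ x → Σℤ (λ y → [ Q x ∧ Q y ] * zetaInv P Q x y) ≡ [ Q x ∧ eqB x m ]
    row x with Q x
    ... | false = Σℤ-zero {size} λ _ → refl
    ... | true  = trans (Σℤ-cong λ y → cong (λ b → [ b ] * zetaInv P Q x y) (Q⊆↓m y))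
                        (möbius-ζ Q size x m Qm (height≤size m))
    off-top : ∀ x → [ not (eqB x m) ] * [ Q x ∧ eqB x m ] ≡ 0ℤ
    off-top x with x ≟ m
    ... | yes _ = refl
    ... | no _  = cong (λ b → 1ℤ * [ b ]) (∧-zeroʳ (Q x))

  evalDecomp : List (ℤ × Subset P) → Elt → ℤ
  evalDecomp d p = foldr (λ aQ acc → proj₁ aQ * [ proj₂ aQ p ] + acc) 0ℤ d

  χ-filter : ∀ {S Q x} → S x ≡ true → (∀ p → S p ≡ true → p ≤ x) →
    IsFilterIn P S Q → χ P Q ≡ [ Q x ]
  χ-filter {Q = Q} {x} Sx ≤x (Q⊆S , Q-up) with Q x in Qx
  ... | true  = χ-top Q x Qx (λ q Qq → ≤x q (Q⊆S q Qq))
  ... | false = χ-empty Q λ q → ¬-not λ Qq →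
    contradiction (trans (sym Qx) (Q-up q x Qq Sx (≤x q (Q⊆S q Qq)))) λ ()

  decompValue-top : ∀ {S x} d → S x ≡ true → (∀ p → S p ≡ true → p ≤ x) →
    All (λ aQ → IsFilterIn P S (proj₂ aQ)) d → decompValue P d ≡ evalDecomp d x
  decompValue-top []            Sx ≤x []                = refl
  decompValue-top ((a , Q) ∷ d) Sx ≤x (Q-filter ∷ filters) =
    cong₂ (λ c t → a * c + t) (χ-filter Sx ≤x Q-filter) (decompValue-top d Sx ≤x filters)

  upSet : Subset P → Elt → Subset P
  upSet S p q = S q ∧ leB p q

  strictUpSet : Subset P → Elt → Subset P
  strictUpSet S p q = S q ∧ (leB p q ∧ not (eqB p q))

  upSet-isFilter : ∀ S p → IsFilterIn P S (upSet S p)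
  upSet-isFilter S p = (λ q q∈ → proj₁ (∧≡true⇒ q∈)) , λ a b a∈ Sb a≤b →
    cong₂ _∧_ Sb (≤⇒leB (≤-trans (leB⇒≤ (proj₂ (∧≡true⇒ a∈))) a≤b))

  strictUpSet-isFilter : ∀ S p → IsFilterIn P S (strictUpSet S p)
  strictUpSet-isFilter S p = (λ q q∈ → proj₁ (∧≡true⇒ q∈)) , λ a b a∈ Sb a≤b →
    let (p≤a , p≠a) = ∧≡true⇒ (proj₂ (∧≡true⇒ {S a} a∈))
        p≤b = ≤-trans (leB⇒≤ p≤a) a≤b
        p≢b = λ p≡b →
          not-eqB⇒≢ p≠a (antisym (leB⇒≤ p≤a) (subst (a ≤_) (sym p≡b) a≤b))
    in cong₂ _∧_ Sb (cong₂ _∧_ (≤⇒leB p≤b) (cong not (⌊⌋≡false (p ≟ b) p≢b)))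

  pointDecomp : Subset P → (Elt → ℤ) → List Elt → List (ℤ × Subset P)
  pointDecomp S h []       = []
  pointDecomp S h (p ∷ ps) =
    (h p , upSet S p) ∷ (- h p , strictUpSet S p) ∷ pointDecomp S h ps

  pointDecomp-filters : ∀ S h ps →
    All (λ aQ → IsFilterIn P S (proj₂ aQ)) (pointDecomp S h ps)
  pointDecomp-filters S h []       = []
  pointDecomp-filters S h (p ∷ ps) =
    upSet-isFilter S p ∷ strictUpSet-isFilter S p ∷ pointDecomp-filters S h ps

  module _ (S : Subset P) (h : Elt → ℤ) (q : Elt) where

    pointTerm : Elt → ℤ
    pointTerm p = h p * [ upSet S p q ] + (- h p) * [ strictUpSet S p q ]

    evalDecomp-pointDecomp : ∀ ps →
      evalDecomp (pointDecomp S h ps) q ≡ foldr (λ p acc → pointTerm p + acc) 0ℤ ps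
    evalDecomp-pointDecomp []       = refl
    evalDecomp-pointDecomp (p ∷ ps) =
      trans (cong (λ t → h p * [ upSet S p q ] + ((- h p) * [ strictUpSet S p q ] + t))
                  (evalDecomp-pointDecomp ps))
            (sym (ℤₚ.+-assoc (h p * [ upSet S p q ]) ((- h p) * [ strictUpSet S p q ]) _))

    pointTerm-diag : S q ≡ true → pointTerm q ≡ h q
    pointTerm-diag Sq = begin
      h q * [ S q ∧ leB q q ] + (- h q) * [ S q ∧ (leB q q ∧ not (eqB q q)) ]
        ≡⟨ cong₂ (λ b c → h q * [ b ] + (- h q) * [ c ])
                 (cong₂ _∧_ Sq q≤q) (cong₂ _∧_ Sq (cong₂ _∧_ q≤q (cong not (eqB-refl q)))) ⟩
      h q * 1ℤ + (- h q) * 0ℤ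
        ≡⟨ cong₂ _+_ (ℤₚ.*-identityʳ (h q)) (ℤₚ.*-zeroʳ (- h q)) ⟩
      h q + 0ℤ
        ≡⟨ ℤₚ.+-identityʳ (h q) ⟩
      h q ∎
      where
      open ≡-Reasoning
      q≤q = ≤⇒leB ≤-refl

    pointTerm-off : ∀ p → not (eqB p q) ≡ true → pointTerm p ≡ 0ℤ
    pointTerm-off p p≠q = begin
      h p * c + (- h p) * [ S q ∧ (leB p q ∧ not (eqB p q)) ]
        ≡⟨ cong (λ b → h p * c + (- h p) * [ S q ∧ b ])
                (trans (cong (leB p q ∧_) p≠q) (∧-identityʳ (leB p q))) ⟩
      h p * c + (- h p) * c
        ≡⟨ cong (h p * c +_) (sym (ℤₚ.neg-distribˡ-* (h p) c)) ⟩
      h p * c + - (h p * c)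
        ≡⟨ ℤₚ.+-inverseʳ (h p * c) ⟩
      0ℤ ∎
      where
      open ≡-Reasoning
      c = [ S q ∧ leB p q ]

    pointDecomp-eval : S q ≡ true → evalDecomp (pointDecomp S h (allFin size)) q ≡ h q
    pointDecomp-eval Sq = begin
      evalDecomp (pointDecomp S h (allFin size)) q
        ≡⟨ evalDecomp-pointDecomp (allFin size) ⟩
      Σℤ pointTerm
        ≡⟨ Σℤ-split-at q pointTerm ⟩
      pointTerm q + Σℤ (λ p → [ not (eqB p q) ] * pointTerm p)
        ≡⟨ cong₂ _+_ (pointTerm-diag Sq) (Σℤ-zero off-diagonal) ⟩
      h q + 0ℤ
        ≡⟨ ℤₚ.+-identityʳ (h q) ⟩
      h q ∎
      where
      open ≡-Reasoning
      off-diagonal : ∀ p → [ not (eqB p q) ] * pointTerm p ≡ 0ℤ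
      off-diagonal p = []*-zero (not (eqB p q)) (pointTerm-off p)

  filterDecomp : ∀ S h → Σ (List (ℤ × Subset P)) (IsFilterDecomp P S h)
  filterDecomp S h = pointDecomp S h (allFin size)
                   , pointDecomp-filters S h (allFin size)
                   , pointDecomp-eval S h

  integral-top : ∀ S x h → S x ≡ true → (∀ p → S p ≡ true → p ≤ x) →
    IntegralIs P S h (h x)
  integral-top S x h Sx ≤x = filterDecomp S h , λ d (filters , d≡h) →
    trans (decompValue-top d Sx ≤x filters) (d≡h x Sx)

proposition4p6 : (P : FinPoset) (r : FinPoset.Elt P → FinPoset.Elt P) →
    IsAscendingClosure P r →
    (h : FinPoset.Elt P → ℤ) →
    (x : FinPoset.Elt P) → ∃ (λ y → r y ≡ x) →
    PushforwardIs P r h x (h x)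
proposition4p6 P r r-closure h x (y , ry≡x) = integral-top P (preimageBelow P r x) x h x∈S S≤x
  where
  open FinPoset P
  open IsDecPartialOrder isDecPartialOrder using () renaming (refl to ≤-refl; trans to ≤-trans)
  open IsAscendingClosure r-closure
  rx≡x : r x ≡ x
  rx≡x = trans (cong r (sym ry≡x)) (trans (idempotent y) ry≡x)
  x∈S : preimageBelow P r x x ≡ true
  x∈S = ≤⇒leB P (subst (_≤ x) (sym rx≡x) ≤-refl)
  S≤x : ∀ p → preimageBelow P r x p ≡ true → p ≤ x
  S≤x p rp≤x = ≤-trans (ascending p) (leB⇒≤ P rp≤x)
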